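{- Let $A$ be a finite abelian group of even order, $T$ a square-free subset of $A$, and $X$ an inverse-closed subset of $A$ (i.e. $-X=X$). Then $X$ is a perfect code of $\mathrm{CayS}(A,T)$ if and only if $A=X\oplus T^0$, where $T^0=T\cup\{0\}$.
   Context: Groups are written additively. An element $x\in A$ is a square if $x=2y$ for some $y\in A$; a subset is square-free if it contains no squares. For a square-free $T\subseteq A$, $\mathrm{CayS}(A,T)$ is the simple graph with vertex set $A$ where distinct $x,y$ are adjacent iff $x+y\in T$. A subset $C$ of vertices of a graph is a perfect code if every vertex is at distance at most one from exactly one vertex of $C$. For subsets $M,N\subseteq A$, $A=M\oplus N$ means every $a\in A$ can be written in exactly one way as $a=m+n$ with $m\in M$, $n\in N$. -}

module Defs where

open import Level using (Level; _⊔_)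
open import Algebra.Bundles using (AbelianGroup)
open import Data.Nat using (ℕ)
open import Data.Nat.Divisibility using (_∣_)
open import Data.Fin using (Fin)
open import Data.Product using (Σ; ∃; ∃₂; _×_; _,_)
open import Data.Sum using (_⊎_)
open import Relation.Nullary using (¬_)
open import Relation.Unary using (Pred)
open import Relation.Binary.PropositionalEquality as ≡ using (_≡_)
open import Function.Bundles using (Inverse)

module _ {c ℓ : Level} (G : AbelianGroup c ℓ) where
  open AbelianGroup G renaming (_∙_ to _+_; ε to 0#; _⁻¹ to -_)

  HasOrder : ℕ → Set (c ⊔ ℓ)
  HasOrder n = Inverse (≡.setoid (Fin n)) setoid

  FiniteEvenOrder : Set (c ⊔ ℓ)
  FiniteEvenOrder = Σ ℕ λ n → HasOrder n × (2 ∣ n)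

  IsSubset : {p : Level} → Pred Carrier p → Set (c ⊔ ℓ ⊔ p)
  IsSubset S = ∀ {x y} → x ≈ y → S x → S y

  IsSquare : Carrier → Set (c ⊔ ℓ)
  IsSquare x = ∃ λ y → x ≈ y + y

  SquareFree : {p : Level} → Pred Carrier p → Set (c ⊔ ℓ ⊔ p)
  SquareFree T = ∀ x → T x → ¬ IsSquare x

  -- -X = X (given closure under ≈, equivalent to -X ⊆ X)
  InverseClosed : {p : Level} → Pred Carrier p → Set (c ⊔ p)
  InverseClosed X = ∀ x → X x → X (- x)

  -- adjacency in CayS(A,T): distinct x, y with x + y ∈ T
  Adj : {p : Level} → Pred Carrier p → Carrier → Carrier → Set (ℓ ⊔ p)
  Adj T x y = ¬ (x ≈ y) × T (x + y)

  Dist≤1 : {p : Level} → Pred Carrier p → Carrier → Carrier → Set (ℓ ⊔ p)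
  Dist≤1 T x y = x ≈ y ⊎ Adj T x y

  PerfectCode : {p q : Level} → Pred Carrier p → Pred Carrier q → Set (c ⊔ ℓ ⊔ p ⊔ q)
  PerfectCode T C =
    ∀ v → (∃ λ x → C x × Dist≤1 T x v)
        × (∀ x y → C x → Dist≤1 T x v → C y → Dist≤1 T y v → x ≈ y)

  WithZero : {p : Level} → Pred Carrier p → Pred Carrier (ℓ ⊔ p)
  WithZero T x = T x ⊎ x ≈ 0#

  DirectSum : {p q : Level} → Pred Carrier p → Pred Carrier q → Set (c ⊔ ℓ ⊔ p ⊔ q)
  DirectSum M N =
    (∀ a → ∃₂ λ m n → M m × N n × a ≈ m + n)
    × (∀ m n m' n' → M m → N n → M m' → N n' → m + n ≈ m' + n' → m ≈ m' × n ≈ n')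

module Submission where

-- In CayS(A,T) with T square-free, the closed neighbourhood of x consists of
-- x itself and the vertices v with x + v ∈ T (square-freeness rules out the
-- loop x + x ∈ T, so adjacency to v ≠ x is just x + v ∈ T).  Hence v lies in
-- the ball of x exactly when v = x + 0 or v = (-x) + t with t ∈ T, and for an
-- inverse-closed X this gives a dictionary between the two notions:
--   * a centre x ∈ X of a ball containing v yields a factorisation
--     v = m + n with m ∈ X, n ∈ T⁰  (namely (x, 0) or (-x, x + v));
--   * a factorisation v = m + n yields a centre: m if n = 0, and -m if n ∈ T.
-- Existence of centres and existence of factorisations thus correspond, and
-- uniqueness transfers in both directions: the "mixed" cases, where one side
-- uses 0 and the other an element of T, are excluded because T contains no
-- squares (neither 0 = 0 + 0 nor (-m) + (-m)).

open import Defs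
open import Level using (Level; _⊔_)
open import Algebra.Bundles using (AbelianGroup)
open import Relation.Unary using (Pred)
open import Relation.Nullary using (¬_)
open import Function.Base using (_∘_)
open import Function.Bundles using (_⇔_; mk⇔)
open import Data.Product using (∃; ∃₂; _×_; _,_; proj₁; proj₂)
open import Data.Sum using (inj₁; inj₂)
open import Data.Empty using (⊥-elim)
import Algebra.Properties.Group as GroupProperties
import Relation.Binary.Reasoning.Setoid as SetoidReasoning

module CodesAndFactorisations {c ℓ p q : Level} (G : AbelianGroup c ℓ)
    (T : Pred (AbelianGroup.Carrier G) p) (T-closed : IsSubset G T) (T-squareFree : SquareFree G T)
    (X : Pred (AbelianGroup.Carrier G) q) (X-inverseClosed : InverseClosed G X) where

  open AbelianGroup G renaming (_∙_ to _+_; ε to 0#; _⁻¹ to -_)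
  open GroupProperties group using (⁻¹-injective; ∙-cancelˡ; \\-leftDividesʳ)
  open SetoidReasoning setoid

  T⁰ : Pred Carrier (ℓ ⊔ p)
  T⁰ = WithZero G T

  Near : Carrier → Carrier → Set (ℓ ⊔ p)
  Near = Dist≤1 G T

  unshift : ∀ x v → (- x) + (x + v) ≈ v
  unshift = \\-leftDividesʳ

  notSquare : ∀ {x} y → x ≈ y + y → ¬ T x
  notSquare {x} y x≈y+y x∈T = T-squareFree x x∈T (y , x≈y+y)

  zero∉T : ¬ T 0#
  zero∉T = notSquare 0# (sym (identityʳ 0#))

  -- square-freeness makes x + v ∈ T a genuine (loop-free) adjacency
  sumInT⇒near : ∀ x v → T (x + v) → Near x v
  sumInT⇒near x v x+v∈T = inj₂ ((λ x≈v → notSquare x (∙-congˡ (sym x≈v)) x+v∈T) , x+v∈T)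

  near-resp : ∀ {x v w} → v ≈ w → Near x v → Near x w
  near-resp v≈w (inj₁ x≈v) = inj₁ (trans x≈v v≈w)
  near-resp v≈w (inj₂ (x≉v , x+v∈T)) =
    inj₂ ((λ x≈w → x≉v (trans x≈w (sym v≈w))) , T-closed (∙-congˡ v≈w) x+v∈T)

  Factorisation : Carrier → Set (c ⊔ ℓ ⊔ p ⊔ q)
  Factorisation v = ∃₂ λ m n → X m × T⁰ n × v ≈ m + n

  factorise : ∀ {x v} → X x → Near x v → Factorisation v
  factorise {x} x∈X (inj₁ x≈v) = x , 0# , x∈X , inj₂ refl , sym (trans (identityʳ x) x≈v)
  factorise {x} {v} x∈X (inj₂ (_ , x+v∈T)) =
    - x , x + v , X-inverseClosed x x∈X , inj₁ x+v∈T , sym (unshift x v)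

  centre : ∀ m {n} → T⁰ n → Carrier
  centre m (inj₁ _) = - m
  centre m (inj₂ _) = m

  centre-covers : ∀ {m n} → X m → (n∈T⁰ : T⁰ n) → X (centre m n∈T⁰) × Near (centre m n∈T⁰) (m + n)
  centre-covers {m} {n} m∈X (inj₁ n∈T) =
    X-inverseClosed m m∈X , sumInT⇒near (- m) (m + n) (T-closed (sym (unshift m n)) n∈T)
  centre-covers {m} m∈X (inj₂ n≈0) = m∈X , inj₁ (sym (trans (∙-congˡ n≈0) (identityʳ m)))

  -- a centre -m (from n ∈ T) never coincides with a centre m' (from n' = 0):
  -- otherwise n = -m + (m' + n') = (-m) + (-m) would be a square in T
  mixedCentres-impossible : ∀ {m n m' n'} → T n → n' ≈ 0# → m + n ≈ m' + n' → ¬ (- m ≈ m')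
  mixedCentres-impossible {m} {n} {m'} {n'} n∈T n'≈0 sums≈ -m≈m' = notSquare (- m) n≈-m-m n∈T
    where
    n≈-m-m : n ≈ (- m) + (- m)
    n≈-m-m = begin
      n                  ≈⟨ unshift m n ⟨
      (- m) + (m + n)    ≈⟨ ∙-congˡ sums≈ ⟩
      (- m) + (m' + n')  ≈⟨ ∙-congˡ (trans (∙-congˡ n'≈0) (identityʳ m')) ⟩
      (- m) + m'         ≈⟨ ∙-congˡ -m≈m' ⟨
      (- m) + (- m)      ∎

  centre-determines-summand : ∀ {m n m' n'} (n∈T⁰ : T⁰ n) (n'∈T⁰ : T⁰ n') → m + n ≈ m' + n' →
                              centre m n∈T⁰ ≈ centre m' n'∈T⁰ → m ≈ m'
  centre-determines-summand (inj₁ _)   (inj₁ _)    _      centres≈ = ⁻¹-injective centres≈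
  centre-determines-summand (inj₂ _)   (inj₂ _)    _      centres≈ = centres≈
  centre-determines-summand (inj₁ n∈T) (inj₂ n'≈0) sums≈ centres≈ =
    ⊥-elim (mixedCentres-impossible n∈T n'≈0 sums≈ centres≈)
  centre-determines-summand (inj₂ n≈0) (inj₁ n'∈T) sums≈ centres≈ =
    ⊥-elim (mixedCentres-impossible n'∈T n≈0 (sym sums≈) (sym centres≈))

  centre-injective : ∀ {m n m' n'} (n∈T⁰ : T⁰ n) (n'∈T⁰ : T⁰ n') → m + n ≈ m' + n' →
                     centre m n∈T⁰ ≈ centre m' n'∈T⁰ → m ≈ m' × n ≈ n'
  centre-injective {m} {n} {m'} {n'} n∈T⁰ n'∈T⁰ sums≈ centres≈ =
    m≈m' , ∙-cancelˡ m n n' (trans sums≈ (∙-congʳ (sym m≈m')))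
    where
    m≈m' : m ≈ m'
    m≈m' = centre-determines-summand n∈T⁰ n'∈T⁰ sums≈ centres≈

  Covering : Set (c ⊔ ℓ ⊔ p ⊔ q)
  Covering = ∀ v → ∃ λ x → X x × Near x v

  UniqueCentres : Set (c ⊔ ℓ ⊔ p ⊔ q)
  UniqueCentres = ∀ v x y → X x → Near x v → X y → Near y v → x ≈ y

  UniqueFactorisations : Set (c ⊔ ℓ ⊔ p ⊔ q)
  UniqueFactorisations = ∀ m n m' n' → X m → T⁰ n → X m' → T⁰ n' → m + n ≈ m' + n' → m ≈ m' × n ≈ n'

  covering⇒factorisable : Covering → ∀ v → Factorisation v
  covering⇒factorisable cover v with cover v
  ... | x , x∈X , near = factorise x∈X near

  factorisable⇒covering : (∀ v → Factorisation v) → Covering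
  factorisable⇒covering factor v with factor v
  ... | m , n , m∈X , n∈T⁰ , v≈m+n with centre-covers m∈X n∈T⁰
  ...   | centre∈X , near = centre m n∈T⁰ , centre∈X , near-resp (sym v≈m+n) near

  -- the centres of two equal sums m + n ≈ m' + n' are centres of the same vertex
  uniqueCentres⇒uniqueFactorisations : UniqueCentres → UniqueFactorisations
  uniqueCentres⇒uniqueFactorisations unique m n m' n' m∈X n∈T⁰ m'∈X n'∈T⁰ sums≈
    with centre-covers m∈X n∈T⁰ | centre-covers m'∈X n'∈T⁰
  ... | c∈X , near | c'∈X , near' =
    centre-injective n∈T⁰ n'∈T⁰ sums≈
      (unique (m + n) (centre m n∈T⁰) (centre m' n'∈T⁰) c∈X near c'∈X (near-resp (sym sums≈) near'))

  -- two centres of v give factorisations of v; if these agree, so do the centres.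
  -- In the mixed case they would force 0 = x + v ∈ T.
  uniqueFactorisations⇒uniqueCentres : UniqueFactorisations → UniqueCentres
  uniqueFactorisations⇒uniqueCentres unique v x y x∈X (inj₁ x≈v) y∈X (inj₁ y≈v) = trans x≈v (sym y≈v)
  uniqueFactorisations⇒uniqueCentres unique v x y x∈X (inj₂ (_ , x+v∈T)) y∈X (inj₂ (_ , y+v∈T)) =
    ⁻¹-injective (proj₁ (unique (- x) (x + v) (- y) (y + v)
      (X-inverseClosed x x∈X) (inj₁ x+v∈T) (X-inverseClosed y y∈X) (inj₁ y+v∈T)
      (trans (unshift x v) (sym (unshift y v)))))
  uniqueFactorisations⇒uniqueCentres unique v x y x∈X (inj₁ x≈v) y∈X (inj₂ (_ , y+v∈T)) =
    ⊥-elim (zero∉T (T-closed (sym 0≈y+v) y+v∈T))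
    where
    0≈y+v : 0# ≈ y + v
    0≈y+v = proj₂ (unique x 0# (- y) (y + v) x∈X (inj₂ refl) (X-inverseClosed y y∈X) (inj₁ y+v∈T)
      (trans (trans (identityʳ x) x≈v) (sym (unshift y v))))
  uniqueFactorisations⇒uniqueCentres unique v x y x∈X (inj₂ (_ , x+v∈T)) y∈X (inj₁ y≈v) =
    ⊥-elim (zero∉T (T-closed x+v≈0 x+v∈T))
    where
    x+v≈0 : x + v ≈ 0#
    x+v≈0 = proj₂ (unique (- x) (x + v) y 0# (X-inverseClosed x x∈X) (inj₁ x+v∈T) y∈X (inj₂ refl)
      (trans (unshift x v) (sym (trans (identityʳ y) y≈v))))

corollary2p6 : {c ℓ p q : Level} (G : AbelianGroup c ℓ) → FiniteEvenOrder G →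
    (T : Pred (AbelianGroup.Carrier G) p) → IsSubset G T → SquareFree G T →
    (X : Pred (AbelianGroup.Carrier G) q) → IsSubset G X → InverseClosed G X →
    PerfectCode G T X ⇔ DirectSum G X (WithZero G T)
corollary2p6 G _ T T-closed T-squareFree X _ X-inverseClosed = mk⇔ toDirectSum toPerfectCode
  where
  open CodesAndFactorisations G T T-closed T-squareFree X X-inverseClosed

  toDirectSum : PerfectCode G T X → DirectSum G X (WithZero G T)
  toDirectSum perfect =
    covering⇒factorisable (proj₁ ∘ perfect) , uniqueCentres⇒uniqueFactorisations (proj₂ ∘ perfect)

  toPerfectCode : DirectSum G X (WithZero G T) → PerfectCode G T X
  toPerfectCode (factor , unique) v =
    factorisable⇒covering factor v , uniqueFactorisations⇒uniqueCentres unique v
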